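{- Let $l\ge 1$; for $1\le i\le l$ let $m_i\ge 2$ be an integer and $x_{i,1}\le x_{i,2}\le\dots\le x_{i,m_i}$ positive integers, with $x_{l,m_l}=1$. Put $y_i=x_{i,1}+\dots+x_{i,m_i-1}$ for $1\le i\le l$ and $y_{l+1}=x_{l,m_l}=1$. Suppose that $x_{i,j}\le y_{i+1}+\dots+y_l+y_{l+1}$ for all $i,j$. Then for every nonnegative integer $z\le N:=y_1+\dots+y_l+y_{l+1}$ there is a subcollection of the numbers $x_{i,j}$ ($1\le i\le l$, $1\le j\le m_i$) whose sum equals $z$. -}

module Defs where

open import Data.Nat using (ℕ; zero; suc; _+_; _∸_; _≤_; _<ᵇ_; s≤s; z≤n)
open import Data.Fin using (Fin; toℕ; fromℕ) renaming (zero to fzero; suc to fsuc)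
open import Data.Bool using (Bool; if_then_else_)

sumFin : ∀ {n} → (Fin n → ℕ) → ℕ
sumFin {zero} f = 0
sumFin {suc n} f = f fzero + sumFin (λ j → f (fsuc j))

lastIdx : ∀ {n} → 1 ≤ n → Fin n
lastIdx {suc n} _ = fromℕ n

-- y_i = x_{i,1} + … + x_{i,m_i - 1}  (sum over 0-based indices j < m_i - 1)
yRow : ∀ (l : ℕ) (m : Fin l → ℕ) (x : (i : Fin l) → Fin (m i) → ℕ) → Fin l → ℕ
yRow l m x i = sumFin (λ j → if toℕ j <ᵇ (m i ∸ 1) then x i j else 0)

yTail : ∀ (l : ℕ) (m : Fin l → ℕ) (x : (i : Fin l) → Fin (m i) → ℕ) → Fin l → ℕ
yTail l m x i = sumFin (λ k → if toℕ i <ᵇ toℕ k then yRow l m x k else 0)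

subSum : ∀ (l : ℕ) (m : Fin l → ℕ) (x : (i : Fin l) → Fin (m i) → ℕ)
         → ((i : Fin l) → Fin (m i) → Bool) → ℕ
subSum l m x S = sumFin (λ i → sumFin (λ j → if S i j then x i j else 0))

2≤⇒1≤ : ∀ {n} → 2 ≤ n → 1 ≤ n
2≤⇒1≤ (s≤s _) = s≤s z≤n

lastEntry : ∀ (l : ℕ) (l≥1 : 1 ≤ l) (m : Fin l → ℕ) (m≥2 : (i : Fin l) → 2 ≤ m i)
            (x : (i : Fin l) → Fin (m i) → ℕ) → ℕ
lastEntry l l≥1 m m≥2 x = x (lastIdx l≥1) (lastIdx (2≤⇒1≤ (m≥2 (lastIdx l≥1))))

module Submission where

-- Idea of the proof.  The numbers y_i form a "greedy-complete" family: we
-- realise z by a greedy choice and absorb the final error with the entry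
-- x_{l,m_l} = 1, which is not counted in any y_i.
--
-- 1. Greedy lemma for a finite sequence a_1, …, a_n with slack c: if every
--    a_j is at most (sum of the later entries) + c, then every
--    z ≤ a_1 + … + a_n + c is a subset sum plus a remainder w ≤ c.
--    (Take a_1 iff z exceeds the total of the rest plus c, then recurse.)
-- 2. The same for a family of rows, where an entry of row i only needs to be
--    bounded by the total of the rows after i plus c: apply step 1 to the
--    first row with slack (rest of the rows + c) and recurse on the rows.
-- 3. The theorem: apply step 2 with c = 1 to x with the last entry of every
--    row masked out (its row totals are exactly the y_i); the remainder
--    w ∈ {0, 1} is then supplied by switching the cell x_{l,m_l} = 1 on or off.

open import Defs
open import Data.Nat using (ℕ; _+_; _≤_)
open import Data.Fin using (Fin) renaming (_≤_ to _≤ᶠ_)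
open import Data.Bool using (Bool)
open import Data.Product using (Σ-syntax)
open import Relation.Binary.PropositionalEquality using (_≡_)

open import Data.Nat using (zero; suc; _∸_; _<ᵇ_; z≤n; s≤s; _≤?_)
open import Data.Nat.Properties
  using (+-identityʳ; +-assoc; ≤-reflexive; +-commutativeSemigroup; ≤-trans; <⇒≤; ≰⇒>;
         m≤n+m; m+[n∸m]≡n; m≤n+o⇒m∸n≤o)
open import Algebra.Properties.CommutativeSemigroup +-commutativeSemigroup
  using (interchange)
open import Data.Fin using (toℕ) renaming (zero to fzero; suc to fsuc)
open import Data.Vec.Functional using (_∷_)
open import Data.Bool using (true; false; if_then_else_)
open import Data.Product using (_,_; _×_)
open import Relation.Binary.PropositionalEquality
  using (refl; sym; trans; cong; cong₂; module ≡-Reasoning)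
open import Relation.Nullary using (Dec; yes; no)

sumFin-cong : ∀ {n} {f g : Fin n → ℕ} → (∀ j → f j ≡ g j) → sumFin f ≡ sumFin g
sumFin-cong {zero}  e = refl
sumFin-cong {suc n} e = cong₂ _+_ (e fzero) (sumFin-cong (λ j → e (fsuc j)))

sumFin-+ : ∀ {n} (f g : Fin n → ℕ) → sumFin (λ j → f j + g j) ≡ sumFin f + sumFin g
sumFin-+ {zero}  f g = refl
sumFin-+ {suc n} f g =
  trans (cong (f fzero + g fzero +_) (sumFin-+ (λ j → f (fsuc j)) (λ j → g (fsuc j))))
        (interchange (f fzero) (g fzero) _ _)

masked : ∀ {n} → Fin n → Bool
masked {n} j = toℕ j <ᵇ n ∸ 1

sumFin-unmasked : ∀ {n} (h : 1 ≤ n) (f : Fin n → ℕ)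
                  → sumFin (λ j → if masked j then 0 else f j) ≡ f (lastIdx h)
sumFin-unmasked {suc zero}    _ f = +-identityʳ (f fzero)
sumFin-unmasked {suc (suc n)} _ f = sumFin-unmasked {suc n} (s≤s z≤n) (λ j → f (fsuc j))

selectSum : ∀ {n} → (Fin n → Bool) → (Fin n → ℕ) → ℕ
selectSum S a = sumFin (λ j → if S j then a j else 0)

laterSum : ∀ {n} → (Fin n → ℕ) → Fin n → ℕ
laterSum a j = sumFin (λ k → if toℕ j <ᵇ toℕ k then a k else 0)

_≲[_]_ : ℕ → ℕ → ℕ → Set
s ≲[ c ] z = Σ[ w ∈ ℕ ] (w ≤ c × s + w ≡ z)

≲-shift : ∀ s {r c t} → r ≲[ c ] t → (s + r) ≲[ c ] (s + t)
≲-shift s {r} (w , w≤c , r+w≡t) = w , w≤c , trans (+-assoc s r w) (cong (s +_) r+w≡t)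

greedy : ∀ {n} (a : Fin n → ℕ) (c : ℕ)
         → (∀ j → a j ≤ laterSum a j + c)
         → ∀ z → z ≤ sumFin a + c
         → Σ[ S ∈ (Fin n → Bool) ] selectSum S a ≲[ c ] z
greedy {zero}  a c bound z z≤ = (λ ()) , z , z≤ , refl
greedy {suc n} a c bound z z≤ = choose (z ≤? sumFin rest + c)
  where
    rest : Fin n → ℕ
    rest k = a (fsuc k)

    greedy-rest : ∀ t → t ≤ sumFin rest + c → Σ[ S ∈ (Fin n → Bool) ] selectSum S rest ≲[ c ] t
    greedy-rest = greedy rest c (λ j → bound (fsuc j))

    choose : Dec (z ≤ sumFin rest + c) → Σ[ S ∈ (Fin (suc n) → Bool) ] selectSum S a ≲[ c ] z
    choose (yes z≤rest) = let (S , under) = greedy-rest z z≤rest in false ∷ S , under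
    -- otherwise a₀ ≤ rest + c < z, so take a₀ and aim for z ∸ a₀ with the rest.
    choose (no z≰rest) =
      let (S , under) = greedy-rest (z ∸ a fzero) z∸a₀≤rest
          (w , w≤c , e) = ≲-shift (a fzero) under
      in  true ∷ S , w , w≤c , trans e (m+[n∸m]≡n a₀≤z)
      where
        a₀≤z : a fzero ≤ z
        a₀≤z = ≤-trans (bound fzero) (<⇒≤ (≰⇒> z≰rest))
        z∸a₀≤rest : z ∸ a fzero ≤ sumFin rest + c
        z∸a₀≤rest = m≤n+o⇒m∸n≤o z (a fzero) (≤-trans z≤ (≤-reflexive (+-assoc (a fzero) _ c)))

consRows : ∀ {l} {m : Fin (suc l) → ℕ} → (Fin (m fzero) → Bool)
           → ((i : Fin l) → Fin (m (fsuc i)) → Bool) → (i : Fin (suc l)) → Fin (m i) → Bool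
consRows S₀ S fzero    = S₀
consRows S₀ S (fsuc i) = S i

greedyRows : ∀ {l} (m : Fin l → ℕ) (a : (i : Fin l) → Fin (m i) → ℕ) (c : ℕ)
             → (∀ i j → a i j ≤ laterSum (λ k → sumFin (a k)) i + c)
             → ∀ z → z ≤ sumFin (λ i → sumFin (a i)) + c
             → Σ[ S ∈ ((i : Fin l) → Fin (m i) → Bool) ] subSum l m a S ≲[ c ] z
greedyRows {zero}  m a c bound z z≤ = (λ ()) , z , z≤ , refl
greedyRows {suc l} m a c bound z z≤ =
  let (S₀ , w₀ , w₀≤ , e₀) = greedy (a fzero) (T + c) first-row-bound z z≤first
      (S , under)         = greedyRows (λ i → m (fsuc i)) (λ i → a (fsuc i)) c
                                       (λ i → bound (fsuc i)) w₀ w₀≤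
      (w , w≤c , e)       = ≲-shift (selectSum S₀ (a fzero)) under
  in  consRows {m = m} S₀ S , w , w≤c , trans e e₀
  where
    T : ℕ
    T = sumFin (λ i → sumFin (a (fsuc i)))
    first-row-bound : ∀ j → a fzero j ≤ laterSum (a fzero) j + (T + c)
    first-row-bound j = ≤-trans (bound fzero j) (m≤n+m (T + c) (laterSum (a fzero) j))
    z≤first : z ≤ sumFin (a fzero) + (T + c)
    z≤first = ≤-trans z≤ (≤-reflexive (+-assoc (sumFin (a fzero)) T c))

-- x with the last entry of every row replaced by 0; its row totals are the y_i.
maskRows : ∀ {l} (m : Fin l → ℕ) → ((i : Fin l) → Fin (m i) → ℕ) → (i : Fin l) → Fin (m i) → ℕ
maskRows m x i j = if masked j then x i j else 0

masked-≤ : ∀ b {u v} → u ≤ v → (if b then u else 0) ≤ v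
masked-≤ true  u≤v = u≤v
masked-≤ false _   = z≤n

-- Keep S on the masked cells and switch on (according to b) the last cell of
-- the last row; all other cells stay off.
completeWith : ∀ {l} {m : Fin l → ℕ} → ((i : Fin l) → Fin (m i) → Bool) → Bool
               → (i : Fin l) → Fin (m i) → Bool
completeWith S b i j = if masked j then S i j else (if masked i then false else b)

-- Contribution of one cell of the completed selection: its masked part plus
-- its part as an unmasked cell of the unmasked (last) row.
cell-split : ∀ (inner outer b s : Bool) (u : ℕ)
  → (if (if inner then s else (if outer then false else b)) then u else 0)
    ≡ (if s then (if inner then u else 0) else 0)
      + (if inner then 0 else (if outer then 0 else (if b then u else 0)))
cell-split true  _     _ true  u = sym (+-identityʳ u)
cell-split true  _     _ false u = refl
cell-split false true  _ true  u = refl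
cell-split false true  _ false u = refl
cell-split false false _ true  u = refl
cell-split false false _ false u = refl

completeWith-sum : ∀ {l} (h : 1 ≤ l) (m : Fin l → ℕ) (hm : ∀ i → 1 ≤ m i)
                   (x : (i : Fin l) → Fin (m i) → ℕ) (S : (i : Fin l) → Fin (m i) → Bool) (b : Bool)
  → subSum l m x (completeWith S b)
    ≡ subSum l m (maskRows m x) S + (if b then x (lastIdx h) (lastIdx (hm (lastIdx h))) else 0)
completeWith-sum {l} h m hm x S b = begin
  subSum l m x (completeWith S b)
    ≡⟨ sumFin-cong (λ i → trans (sumFin-cong (λ j → cell-split (masked j) (masked i) b (S i j) (x i j)))
                                (sumFin-+ (P i) (Q i))) ⟩
  sumFin (λ i → sumFin (P i) + sumFin (Q i))
    ≡⟨ sumFin-+ (λ i → sumFin (P i)) (λ i → sumFin (Q i)) ⟩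
  subSum l m (maskRows m x) S + sumFin (λ i → sumFin (Q i))
    ≡⟨ cong (subSum l m (maskRows m x) S +_)
            (trans (sumFin-cong (λ i → sumFin-unmasked (hm i) (lastRowOnly i)))
                   (sumFin-unmasked h (λ i → if b then x i (lastIdx (hm i)) else 0))) ⟩
  subSum l m (maskRows m x) S + (if b then x (lastIdx h) (lastIdx (hm (lastIdx h))) else 0) ∎
  where
    open ≡-Reasoning
    P Q : (i : Fin l) → Fin (m i) → ℕ
    P i j = if S i j then maskRows m x i j else 0
    Q i j = if masked j then 0 else (if masked i then 0 else (if b then x i j else 0))
    lastRowOnly : (i : Fin l) → Fin (m i) → ℕ
    lastRowOnly i j = if masked i then 0 else (if b then x i j else 0)

bit-for : ∀ {v} w → w ≤ 1 → v ≡ 1 → Σ[ b ∈ Bool ] (if b then v else 0) ≡ w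
bit-for zero          _ _   = false , refl
bit-for (suc zero)    _ v≡1 = true , v≡1
bit-for (suc (suc w)) (s≤s ()) _

lemma1 : (l : ℕ) (l≥1 : 1 ≤ l) (m : Fin l → ℕ) (m≥2 : (i : Fin l) → 2 ≤ m i)
         (x : (i : Fin l) → Fin (m i) → ℕ)
         → ((i : Fin l) (j : Fin (m i)) → 1 ≤ x i j)
         → ((i : Fin l) (j k : Fin (m i)) → j ≤ᶠ k → x i j ≤ x i k)
         → lastEntry l l≥1 m m≥2 x ≡ 1
         → ((i : Fin l) (j : Fin (m i)) → x i j ≤ yTail l m x i + 1)
         → (z : ℕ) → z ≤ sumFin (yRow l m x) + 1
         → Σ[ S ∈ ((i : Fin l) → Fin (m i) → Bool) ] subSum l m x S ≡ z
lemma1 l l≥1 m m≥2 x _ _ last≡1 x≤yTail z z≤N =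
  let
      (S , w , w≤1 , S+w≡z) = greedyRows m (maskRows m x) 1
                                (λ i j → masked-≤ (masked j) (x≤yTail i j)) z z≤N
      -- w is supplied by the last cell x_{l,m_l} = 1
      (b , last≡w) = bit-for w w≤1 last≡1
  in  completeWith S b
    , trans (completeWith-sum l≥1 m (λ i → 2≤⇒1≤ (m≥2 i)) x S b)
            (trans (cong (subSum l m (maskRows m x) S +_) last≡w) S+w≡z)
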